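{- Let $\alpha$ be a growth which contains a slow function. Then for every chunk $E\subseteq S_\alpha(\omega)$ there is a slow $g\in\alpha$ such that every element of $E$ is bounded by $g$.
   Context: $\mathbb{N}_\infty=\mathbb{N}\cup\{\infty\}$. $\Omega_\infty$ is the set of all $g:\mathbb{N}_\infty\to\mathbb{N}_\infty$ with $g(n+1)\ge g(n)>n$ for all $n\in\mathbb{N}$ and $g(\infty)=\infty$. For $f,g\in\Omega_\infty$: $f\prec g$ iff $f(n)<g(n)$ for all sufficiently large $n$; $f\sim g$ iff there is $k$ with $f\prec g^k$ and $g\prec f^k$ ($k$-th compositional powers). The $\sim$-classes are called growths. $g$ is slow if $\lim_{n\to\infty}n/g(n)=1$. $S(\omega)$ is the group of all permutations of $\mathbb{N}$. A permutation $\rho$ is bounded by $g\in\Omega_\infty$ if $\rho(m)\le g(n)$ for all $n\in\mathbb{N}$ and all $m\le n$. For a growth $\alpha$, $S_\alpha(\omega)=\{\rho\in S(\omega):\rho$ and $\rho^{ -1}$ are bounded by some $g\in\alpha\}$. A chunk of a group is a finite subset containing the identity. -}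

module Defs where

open import Data.Nat as ℕ using (ℕ; zero; suc; _≤_)
open import Data.Integer as ℤ using (ℤ)
open import Data.Rational as ℚ using (ℚ; 0ℚ; 1ℚ)
open import Data.Product using (Σ; _×_; ∃)
open import Data.List using (List)
open import Data.List.Relation.Unary.Any using (Any)
open import Function using (_↔_; Inverse)
open import Relation.Binary.PropositionalEquality using (_≡_)

data ℕ∞ : Set where
  fin : ℕ → ℕ∞
  ∞   : ℕ∞

data _<∞_ : ℕ∞ → ℕ∞ → Set where
  fin<fin : ∀ {m n} → m ℕ.< n → fin m <∞ fin n
  fin<∞   : ∀ {m} → fin m <∞ ∞

data _≤∞_ : ℕ∞ → ℕ∞ → Set where
  fin≤fin : ∀ {m n} → m ≤ n → fin m ≤∞ fin n
  ≤top    : ∀ {x} → x ≤∞ ∞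

record InΩ (g : ℕ∞ → ℕ∞) : Set where
  field
    mono   : ∀ n → g (fin n) ≤∞ g (fin (suc n))
    above  : ∀ n → fin n <∞ g (fin n)
    at-∞   : g ∞ ≡ ∞

_^_ : (ℕ∞ → ℕ∞) → ℕ → (ℕ∞ → ℕ∞)
(g ^ zero) x = x
(g ^ suc k) x = g ((g ^ k) x)

_≺_ : (ℕ∞ → ℕ∞) → (ℕ∞ → ℕ∞) → Set
f ≺ g = ∃ λ N → ∀ n → N ≤ n → f (fin n) <∞ g (fin n)

_∼_ : (ℕ∞ → ℕ∞) → (ℕ∞ → ℕ∞) → Set
f ∼ g = ∃ λ k → (f ≺ (g ^ k)) × (g ≺ (f ^ k))

-- the rational number n / g(n)  (n / ∞ = 0; the case g(n) = 0 never occurs in Ω∞)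
ratio : ℕ → ℕ∞ → ℚ
ratio n (fin zero)    = 0ℚ
ratio n (fin (suc m)) = ℤ.+ n ℚ./ suc m
ratio n ∞             = 0ℚ

Slow : (ℕ∞ → ℕ∞) → Set
Slow g = ∀ (ε : ℚ) → 0ℚ ℚ.< ε →
  ∃ λ N → ∀ n → N ≤ n → ℚ.∣ ratio n (g (fin n)) ℚ.- 1ℚ ∣ ℚ.< ε

BoundedBy : (ℕ → ℕ) → (ℕ∞ → ℕ∞) → Set
BoundedBy ρ g = ∀ n m → m ≤ n → fin (ρ m) ≤∞ g (fin n)

-- ρ ∈ S_α(ω) where α is the growth (∼-class) of h
InS : (ℕ∞ → ℕ∞) → (ℕ ↔ ℕ) → Set
InS h ρ = Σ (ℕ∞ → ℕ∞) λ g → InΩ g × (g ∼ h) ×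
  (BoundedBy (Inverse.to ρ) g × BoundedBy (Inverse.from ρ) g)

-- a chunk: a finite list of permutations containing the identity
ContainsId : List (ℕ ↔ ℕ) → Set
ContainsId E = Any (λ ρ → ∀ x → Inverse.to ρ x ≡ x) E

module Submission where

-- Let h ∈ Ω∞ be slow.  Each ρ in the chunk E is bounded by some
-- g_ρ ∼ h, hence g_ρ ≺ h^k for some k; the pointwise maximum G of these bounds
-- is monotone, bounds every ρ and satisfies G ≺ h^K for one K.  Put
--   g = h^(K+1) ⊔ G.
-- Then g ∈ Ω∞, g bounds E, and g agrees with h^(K+1) for large n.  Slowness is
-- handled in an arithmetic form (Slowℕ: for every p, eventually g(n) = m is
-- finite with (m − n)(p+1) < m), which is equivalent to the rational definition
-- and is visibly closed under composition and eventual equality; so h^(K+1)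
-- and hence g are slow.  Finally g ∼ h because h ≤ g, g is eventually finite
-- and g = h^(K+1) eventually.

open import Defs
open import Data.Nat as ℕ using (ℕ; zero; suc; _+_; _*_; _∸_; _⊔_; _≤_; _<_; z≤n; s≤s)
import Data.Nat.Properties as ℕP
open import Data.Nat.Solver using (module +-*-Solver)
open import Data.Nat.Coprimality using (Coprime; 1-coprimeTo)
open import Data.Integer as ℤ using (+_)
import Data.Integer.Properties as ℤP
open import Data.Rational as ℚ using (ℚ; 0ℚ; 1ℚ; mkℚ; toℚᵘ)
import Data.Rational.Properties as ℚP
open import Data.Rational.Unnormalised as ℚᵘ using (mkℚᵘ; *≡*; *<*)
import Data.Rational.Unnormalised.Properties as ℚᵘP
open import Data.Product using (Σ; _×_; ∃; _,_)
open import Data.Sum using (inj₁; inj₂)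
open import Data.Empty using (⊥-elim)
open import Data.List using (List; []; _∷_)
open import Data.List.Relation.Unary.All as All using (All; []; _∷_)
open import Function using (_↔_; Inverse)
open import Relation.Binary.PropositionalEquality

Eventually : (ℕ → Set) → Set
Eventually P = ∃ λ N → ∀ n → N ≤ n → P n

eventually-map : {P Q : ℕ → Set} → (∀ {n} → P n → Q n) → Eventually P → Eventually Q
eventually-map f (N , p) = N , λ n N≤n → f (p n N≤n)

eventually-both : {P Q : ℕ → Set} → Eventually P → Eventually Q →
  Eventually (λ n → P n × Q n)
eventually-both (N , p) (M , q) =
  N ⊔ M , λ n le → p n (ℕP.m⊔n≤o⇒m≤o N M le) , q n (ℕP.m⊔n≤o⇒n≤o N M le)

≤∞-refl : ∀ {x} → x ≤∞ x
≤∞-refl {fin n} = fin≤fin ℕP.≤-refl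
≤∞-refl {∞}     = ≤top

≤∞-trans : ∀ {x y z} → x ≤∞ y → y ≤∞ z → x ≤∞ z
≤∞-trans (fin≤fin a) (fin≤fin b) = fin≤fin (ℕP.≤-trans a b)
≤∞-trans _           ≤top        = ≤top

<-≤∞-trans : ∀ {x y z} → x <∞ y → y ≤∞ z → x <∞ z
<-≤∞-trans (fin<fin a) (fin≤fin b) = fin<fin (ℕP.<-≤-trans a b)
<-≤∞-trans (fin<fin a) ≤top        = fin<∞
<-≤∞-trans fin<∞       ≤top        = fin<∞

≤-<∞-trans : ∀ {x y z} → x ≤∞ y → y <∞ z → x <∞ z
≤-<∞-trans (fin≤fin a) (fin<fin b) = fin<fin (ℕP.≤-<-trans a b)
≤-<∞-trans (fin≤fin a) fin<∞       = fin<∞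

<⇒≤∞ : ∀ {x y} → x <∞ y → x ≤∞ y
<⇒≤∞ (fin<fin a) = fin≤fin (ℕP.<⇒≤ a)
<⇒≤∞ fin<∞       = ≤top

Finite : ℕ∞ → Set
Finite x = ∃ λ m → x ≡ fin m

MonotoneOnℕ : (ℕ∞ → ℕ∞) → Set
MonotoneOnℕ g = ∀ n → g (fin n) ≤∞ g (fin (suc n))

monotoneOnℕ-≤′ : ∀ {g} → MonotoneOnℕ g → ∀ {a b} → a ℕ.≤′ b → g (fin a) ≤∞ g (fin b)
monotoneOnℕ-≤′     M ℕ.≤′-refl            = ≤∞-refl
monotoneOnℕ-≤′ {g} M (ℕ.≤′-step {n} a≤′n) = ≤∞-trans (monotoneOnℕ-≤′ {g} M a≤′n) (M n)

Ω-mono : ∀ {g} → InΩ g → ∀ {x y} → x ≤∞ y → g x ≤∞ g y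
Ω-mono {g} G (fin≤fin a≤b) = monotoneOnℕ-≤′ {g} (InΩ.mono G) (ℕP.≤⇒≤′ a≤b)
Ω-mono G ≤top rewrite InΩ.at-∞ G = ≤top

Ω-inflationary : ∀ {g} → InΩ g → ∀ x → x ≤∞ g x
Ω-inflationary G (fin n) = <⇒≤∞ (InΩ.above G n)
Ω-inflationary G ∞ rewrite InΩ.at-∞ G = ≤top

Ω-finite-< : ∀ {g} → InΩ g → ∀ {x} → Finite x → x <∞ g x
Ω-finite-< G (m , refl) = InΩ.above G m

Ω-∘ : ∀ {f g} → InΩ f → InΩ g → InΩ (λ x → g (f x))
Ω-∘ {f} {g} F G = record
  { mono  = λ n → Ω-mono G (InΩ.mono F n)
  ; above = λ n → <-≤∞-trans (InΩ.above F n) (Ω-inflationary G (f (fin n)))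
  ; at-∞  = trans (cong g (InΩ.at-∞ F)) (InΩ.at-∞ G)
  }

Ω-^ : ∀ {h} → InΩ h → ∀ k → InΩ (h ^ suc k)
Ω-^ H zero    = H
Ω-^ H (suc k) = Ω-∘ (Ω-^ H k) H

^-≤′ : ∀ {h} → InΩ h → ∀ {k K} → k ℕ.≤′ K → ∀ x → (h ^ k) x ≤∞ (h ^ K) x
^-≤′ H ℕ.≤′-refl        x = ≤∞-refl
^-≤′ H (ℕ.≤′-step k≤′K) x = ≤∞-trans (^-≤′ H k≤′K x) (Ω-inflationary H _)

^-≤ : ∀ {h} → InΩ h → ∀ {k K} → k ≤ K → ∀ x → (h ^ k) x ≤∞ (h ^ K) x
^-≤ H k≤K = ^-≤′ H (ℕP.≤⇒≤′ k≤K)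

≺-weaken : ∀ {f g g′} → (∀ n → g (fin n) ≤∞ g′ (fin n)) → f ≺ g → f ≺ g′
≺-weaken g≤g′ = eventually-map λ {n} f<g → <-≤∞-trans f<g (g≤g′ n)

≺-^-raise : ∀ {f h} → InΩ h → ∀ {k K} → k ≤ K → f ≺ (h ^ k) → f ≺ (h ^ K)
≺-^-raise {f} {h} H {k} {K} k≤K = ≺-weaken {f} {h ^ k} {h ^ K} (λ n → ^-≤ H k≤K (fin n))

infixl 30 _⊔∞_

_⊔∞_ : ℕ∞ → ℕ∞ → ℕ∞
fin a ⊔∞ fin b = fin (a ⊔ b)
fin a ⊔∞ ∞     = ∞
∞     ⊔∞ y     = ∞

≤⊔∞ˡ : ∀ x y → x ≤∞ x ⊔∞ y
≤⊔∞ˡ (fin a) (fin b) = fin≤fin (ℕP.m≤m⊔n a b)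
≤⊔∞ˡ (fin a) ∞       = ≤top
≤⊔∞ˡ ∞       y       = ≤top

≤⊔∞ʳ : ∀ x y → y ≤∞ x ⊔∞ y
≤⊔∞ʳ (fin a) (fin b) = fin≤fin (ℕP.m≤n⊔m a b)
≤⊔∞ʳ (fin a) ∞       = ≤top
≤⊔∞ʳ ∞       y       = ≤top

⊔∞-mono : ∀ {x x′ y y′} → x ≤∞ x′ → y ≤∞ y′ → x ⊔∞ y ≤∞ x′ ⊔∞ y′
⊔∞-mono (fin≤fin a) (fin≤fin b) = fin≤fin (ℕP.⊔-mono-≤ a b)
⊔∞-mono (fin≤fin a) ≤top        = ≤top
⊔∞-mono ≤top        _           = ≤top

⊔∞-lub-< : ∀ {x y z} → x <∞ z → y <∞ z → x ⊔∞ y <∞ z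
⊔∞-lub-< (fin<fin a) (fin<fin b) = fin<fin (ℕP.⊔-lub a b)
⊔∞-lub-< fin<∞       fin<∞       = fin<∞

⊔∞-absorb : ∀ {x y} → y <∞ x → x ⊔∞ y ≡ x
⊔∞-absorb (fin<fin y<x) = cong fin (ℕP.m≥n⇒m⊔n≡m (ℕP.<⇒≤ y<x))
⊔∞-absorb fin<∞         = refl

_⊔ᶠ_ : (ℕ∞ → ℕ∞) → (ℕ∞ → ℕ∞) → (ℕ∞ → ℕ∞)
(f ⊔ᶠ g) x = f x ⊔∞ g x

⊔ᶠ-Ω : ∀ {f G} → InΩ f → MonotoneOnℕ G → InΩ (f ⊔ᶠ G)
⊔ᶠ-Ω {f} {G} F G-mono = record
  { mono  = λ n → ⊔∞-mono (InΩ.mono F n) (G-mono n)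
  ; above = λ n → <-≤∞-trans (InΩ.above F n) (≤⊔∞ˡ _ _)
  ; at-∞  = cong (_⊔∞ G ∞) (InΩ.at-∞ F)
  }

≺-⊔ᶠ : ∀ {f g h} → f ≺ h → g ≺ h → (f ⊔ᶠ g) ≺ h
≺-⊔ᶠ f≺h g≺h = eventually-map (λ (f<h , g<h) → ⊔∞-lub-< f<h g<h) (eventually-both f≺h g≺h)

-- Arithmetic form of slowness.  "Near p n x": x is a finite m ≥ n whose excess
-- over n is small relative to m, namely (m − n)(p+1) < m, i.e. |n/m − 1| < 1/(p+1).

Near : ℕ → ℕ → ℕ∞ → Set
Near p n x = ∃ λ m → x ≡ fin m × n ≤ m × (m ∸ n) * suc p < m

Slowℕ : (ℕ∞ → ℕ∞) → Set
Slowℕ g = ∀ p → Eventually (λ n → Near p n (g (fin n)))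

∣n-m∣ : ∀ n m → n ≤ m → ℤ.∣ (+ n ℤ.* + 1) ℤ.+ ℤ.-1ℤ ℤ.* + m ∣ ≡ m ∸ n
∣n-m∣ n m n≤m = begin
  ℤ.∣ (+ n ℤ.* + 1) ℤ.+ ℤ.-1ℤ ℤ.* + m ∣
    ≡⟨ cong ℤ.∣_∣ (cong₂ ℤ._+_ (ℤP.*-identityʳ (+ n)) (ℤP.-1*i≡-i (+ m))) ⟩
  ℤ.∣ + n ℤ.- + m ∣ ≡⟨ cong ℤ.∣_∣ (ℤP.m-n≡m⊖n n m) ⟩
  ℤ.∣ n ℤ.⊖ m ∣     ≡⟨ ℤP.∣m⊖n∣≡∣n⊖m∣ n m ⟩
  ℤ.∣ m ℤ.⊖ n ∣     ≡⟨ cong ℤ.∣_∣ (ℤP.⊖-≥ n≤m) ⟩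
  m ∸ n             ∎
  where open ≡-Reasoning

ratio-distance : ∀ n m → n ≤ suc m →
  toℚᵘ ℚ.∣ ratio n (fin (suc m)) ℚ.- 1ℚ ∣ ℚᵘ.≃ mkℚᵘ (+ (suc m ∸ n)) m
ratio-distance n m n≤m = begin
  toℚᵘ ℚ.∣ r ℚ.- 1ℚ ∣                      ≈⟨ ℚP.toℚᵘ-homo-∣-∣ (r ℚ.- 1ℚ) ⟩
  ℚᵘ.∣ toℚᵘ (r ℚ.- 1ℚ) ∣                    ≈⟨ ℚᵘP.∣-∣-cong (ℚP.toℚᵘ-homo-+ r (ℚ.- 1ℚ)) ⟩
  ℚᵘ.∣ toℚᵘ r ℚᵘ.+ toℚᵘ (ℚ.- 1ℚ) ∣          ≈⟨ ℚᵘP.∣-∣-cong (ℚᵘP.+-congˡ (toℚᵘ (ℚ.- 1ℚ))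
                                                 (ℚP.toℚᵘ-fromℚᵘ (mkℚᵘ (+ n) m))) ⟩
  ℚᵘ.∣ mkℚᵘ (+ n) m ℚᵘ.+ toℚᵘ (ℚ.- 1ℚ) ∣    ≈⟨ unnormalised ⟩
  mkℚᵘ (+ (suc m ∸ n)) m                   ∎
  where
  open ℚᵘP.≃-Reasoning
  r = ratio n (fin (suc m))
  unnormalised : ℚᵘ.∣ mkℚᵘ (+ n) m ℚᵘ.+ toℚᵘ (ℚ.- 1ℚ) ∣ ℚᵘ.≃ mkℚᵘ (+ (suc m ∸ n)) m
  unnormalised rewrite ∣n-m∣ n (suc m) n≤m | ℕP.*-identityʳ m = *≡* refl

ℤ*<⇒ℕ*< : ∀ a b c d → + a ℤ.* + b ℤ.< + c ℤ.* + d → a * b < c * d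
ℤ*<⇒ℕ*< a b c d lt rewrite sym (ℤP.pos-* a b) | sym (ℤP.pos-* c d) = ℤP.drop‿+<+ lt

ℕ*<⇒ℤ*< : ∀ a b c d → a * b < c * d → + a ℤ.* + b ℤ.< + c ℤ.* + d
ℕ*<⇒ℤ*< a b c d lt rewrite sym (ℤP.pos-* a b) | sym (ℤP.pos-* c d) = ℤ.+<+ lt

unitFrac : ℕ → ℚ
unitFrac p = mkℚ (+ 1) p (1-coprimeTo (suc p))

0<unitFrac : ∀ p → 0ℚ ℚ.< unitFrac p
0<unitFrac p = ℚP.toℚᵘ-cancel-< (*<* (ℤ.+<+ (s≤s z≤n)))

close⇒near : ∀ p n x → fin n <∞ x → ℚ.∣ ratio n x ℚ.- 1ℚ ∣ ℚ.< unitFrac p → Near p n x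
close⇒near p n (fin zero) (fin<fin ()) close
close⇒near p n (fin (suc m)) (fin<fin n<m) close =
  suc m , refl , ℕP.<⇒≤ n<m , subst ((suc m ∸ n) * suc p <_) (ℕP.*-identityˡ (suc m)) excess
  where
  excess : (suc m ∸ n) * suc p < 1 * suc m
  excess with ℚᵘP.<-respˡ-≃ (ratio-distance n m (ℕP.<⇒≤ n<m)) (ℚP.toℚᵘ-mono-< close)
  ... | *<* lt = ℤ*<⇒ℕ*< (suc m ∸ n) (suc p) 1 (suc m) lt
close⇒near p n ∞ fin<∞ close with ℚP.toℚᵘ-mono-< close
... | *<* lt with ℤ*<⇒ℕ*< 1 (suc p) 1 1 lt
...   | s≤s ()

positive-numerator : ∀ a d .(c : Coprime ℤ.∣ a ∣ (suc d)) → 0ℚ ℚ.< mkℚ a d c →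
  ∃ λ a′ → a ≡ + suc a′
positive-numerator (+ zero) d c pos with ℚP.toℚᵘ-mono-< pos
... | *<* (ℤ.+<+ ())
positive-numerator (+ suc a′) d c pos = a′ , refl
positive-numerator (ℤ.-[1+ k ]) d c pos with ℚP.toℚᵘ-mono-< pos
... | *<* ()

near⇒close : ∀ d n x a .(c : Coprime (suc a) (suc d)) → Near d n x →
  ℚ.∣ ratio n x ℚ.- 1ℚ ∣ ℚ.< mkℚ (+ suc a) d c
near⇒close d n .(fin zero) a c (zero , refl , n≤m , ())
near⇒close d n .(fin (suc m)) a c (suc m , refl , n≤m , excess) =
  ℚP.toℚᵘ-cancel-< (ℚᵘP.<-respˡ-≃ (ℚᵘP.≃-sym (ratio-distance n m n≤m))
    (*<* (ℕ*<⇒ℤ*< (suc m ∸ n) (suc d) (suc a) (suc m)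
      (ℕP.<-≤-trans excess (ℕP.m≤n*m (suc m) (suc a))))))

-- The two forms of slowness agree (the first direction uses g(n) > n).

slow⇒slowℕ : ∀ {h} → InΩ h → Slow h → Slowℕ h
slow⇒slowℕ {h} H slow p = eventually-map (λ {n} → close⇒near p n (h (fin n)) (InΩ.above H n))
                            (slow (unitFrac p) (0<unitFrac p))

slowℕ⇒slow : ∀ {g} → Slowℕ g → Slow g
slowℕ⇒slow {g} slow (mkℚ a d c) pos with positive-numerator a d c pos
... | a′ , refl = eventually-map (λ {n} → near⇒close d n (g (fin n)) a′ c) (slow d)

-- Relative excesses add up: two steps n ≤ b ≤ c, each with excess below
-- 1/(2(p+1)), give a total step with excess below 1/(p+1).

half-< : ∀ x c → x + x < c + c → x < c
half-< x c x+x<c+c with ℕP.<-≤-connex x c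
... | inj₁ x<c = x<c
... | inj₂ c≤x = ⊥-elim (ℕP.<-irrefl refl (ℕP.<-≤-trans x+x<c+c (ℕP.+-mono-≤ c≤x c≤x)))

excess-compose : ∀ p n b c → n ≤ b → b ≤ c →
  (b ∸ n) * (suc p + suc p) < b → (c ∸ b) * (suc p + suc p) < c →
  (c ∸ n) * suc p < c
excess-compose p n b c n≤b b≤c first second =
  half-< ((c ∸ n) * suc p) c (subst (_< c + c) (sym doubled) sum<)
  where
  open +-*-Solver
  c∸n : c ∸ n ≡ (c ∸ b) + (b ∸ n)
  c∸n = begin
    c ∸ n             ≡⟨ cong (_∸ n) (sym (ℕP.m∸n+n≡m b≤c)) ⟩
    (c ∸ b) + b ∸ n   ≡⟨ ℕP.+-∸-assoc (c ∸ b) n≤b ⟩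
    (c ∸ b) + (b ∸ n) ∎
    where open ≡-Reasoning
  distrib : ∀ A B s → (A + B) * s + (A + B) * s ≡ A * (s + s) + B * (s + s)
  distrib = solve 3 (λ A B s → (A :+ B) :* s :+ (A :+ B) :* s := A :* (s :+ s) :+ B :* (s :+ s)) refl
  doubled : (c ∸ n) * suc p + (c ∸ n) * suc p ≡ (c ∸ b) * (suc p + suc p) + (b ∸ n) * (suc p + suc p)
  doubled rewrite c∸n = distrib (c ∸ b) (b ∸ n) (suc p)
  sum< : (c ∸ b) * (suc p + suc p) + (b ∸ n) * (suc p + suc p) < c + c
  sum< = ℕP.+-mono-< second (ℕP.<-≤-trans first b≤c)

-- Slow functions are closed under composition (this is where slowness is used:
-- f(n) ≥ n is large whenever n is, so g is near-identity at f(n) as well).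
slowℕ-∘ : ∀ {f g} → Slowℕ f → Slowℕ g → Slowℕ (λ x → g (f x))
slowℕ-∘ {f} {g} f-slow g-slow p with f-slow (p + suc p) | g-slow (p + suc p)
... | N , f-near | M , g-near =
  N ⊔ M , λ n le → compose n (ℕP.m⊔n≤o⇒n≤o N M le) (f-near n (ℕP.m⊔n≤o⇒m≤o N M le))
  where
  compose : ∀ n → M ≤ n → Near (p + suc p) n (f (fin n)) → Near p n (g (f (fin n)))
  compose n M≤n (b , fn≡b , n≤b , first) with g-near b (ℕP.≤-trans M≤n n≤b)
  ... | c , gb≡c , b≤c , second =
    c , trans (cong g fn≡b) gb≡c , ℕP.≤-trans n≤b b≤c , excess-compose p n b c n≤b b≤c first second

slowℕ-^ : ∀ {h} → Slowℕ h → ∀ k → Slowℕ (h ^ suc k)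
slowℕ-^ h-slow zero        = h-slow
slowℕ-^ {h} h-slow (suc k) = slowℕ-∘ {h ^ suc k} {h} (slowℕ-^ {h} h-slow k) h-slow

slowℕ-eventual : ∀ {f g} → Eventually (λ n → g (fin n) ≡ f (fin n)) → Slowℕ f → Slowℕ g
slowℕ-eventual g≡f f-slow p =
  eventually-map (λ (gn≡fn , m , fn≡m , near) → m , trans gn≡fn fn≡m , near)
                 (eventually-both g≡f (f-slow p))

slowℕ-finite : ∀ {f} → Slowℕ f → Eventually (λ n → Finite (f (fin n)))
slowℕ-finite f-slow = eventually-map (λ (m , fn≡m , _) → m , fn≡m) (f-slow 0)

BoundsAll : (ℕ∞ → ℕ∞) → List (ℕ ↔ ℕ) → Set
BoundsAll G E = All (λ ρ → BoundedBy (Inverse.to ρ) G) E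

boundedBy-weaken : ∀ {ρ G G′} → (∀ x → G x ≤∞ G′ x) → BoundedBy ρ G → BoundedBy ρ G′
boundedBy-weaken G≤G′ bounded n m m≤n = ≤∞-trans (bounded n m m≤n) (G≤G′ (fin n))

boundsAll-weaken : ∀ {G G′} → (∀ x → G x ≤∞ G′ x) → ∀ {E} → BoundsAll G E → BoundsAll G′ E
boundsAll-weaken G≤G′ = All.map (boundedBy-weaken G≤G′)

chunk-bound : ∀ {h} → InΩ h → (E : List (ℕ ↔ ℕ)) → All (InS h) E →
  Σ (ℕ∞ → ℕ∞) λ G → Σ ℕ λ K → MonotoneOnℕ G × G ≺ (h ^ K) × BoundsAll G E
chunk-bound H [] [] = (λ _ → fin 0) , 0 , (λ n → fin≤fin z≤n) , (1 , λ n 1≤n → fin<fin 1≤n) , []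
chunk-bound {h} H (ρ ∷ E) ((gρ , gρ-Ω , (k , gρ≺hᵏ , _) , ρ-bounded , _) ∷ E-in)
  with chunk-bound H E E-in
... | G , K , G-mono , G≺hᴷ , E-bounded =
  gρ ⊔ᶠ G , k ⊔ K , (λ n → ⊔∞-mono (InΩ.mono gρ-Ω n) (G-mono n)) ,
  ≺-⊔ᶠ {gρ} {G} {h ^ (k ⊔ K)} (≺-^-raise {gρ} H (ℕP.m≤m⊔n k K) gρ≺hᵏ) (≺-^-raise {G} H (ℕP.m≤n⊔m k K) G≺hᴷ) ,
  boundedBy-weaken (λ x → ≤⊔∞ˡ (gρ x) (G x)) ρ-bounded ∷
  boundsAll-weaken (λ x → ≤⊔∞ʳ (gρ x) (G x)) E-bounded

eventual-power-∼ : ∀ {h g} k → InΩ h → InΩ g → (∀ n → h (fin n) ≤∞ g (fin n)) →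
  Eventually (λ n → g (fin n) ≡ (h ^ suc k) (fin n)) →
  Eventually (λ n → Finite (g (fin n))) → g ∼ h
eventual-power-∼ {h} {g} k H G h≤g g≡hᵏ g-finite = suc (suc k) , g≺hᵏ⁺² , h≺gᵏ⁺²
  where
  -- g(n) = h^(k+1)(n) < h(h^(k+1)(n)) once this value is finite
  g≺hᵏ⁺² : g ≺ (h ^ suc (suc k))
  g≺hᵏ⁺² = eventually-map
    (λ {n} (gn≡hᵏn , gn-finite) → subst (λ z → g (fin n) <∞ h z) gn≡hᵏn (Ω-finite-< H gn-finite))
    (eventually-both g≡hᵏ g-finite)
  -- h(n) ≤ g(n) < g(g(n)) ≤ g(g^(k+1)(n))
  h≺gᵏ⁺² : h ≺ (g ^ suc (suc k))
  h≺gᵏ⁺² = eventually-map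
    (λ {n} gn-finite → ≤-<∞-trans (h≤g n)
      (<-≤∞-trans (Ω-finite-< G gn-finite) (Ω-mono G (^-≤ G {1} {suc k} (s≤s z≤n) (fin n)))))
    g-finite

corollary3p1 : (h : ℕ∞ → ℕ∞) → InΩ h → Slow h →
    (E : List (ℕ ↔ ℕ)) → ContainsId E → All (InS h) E →
    Σ (ℕ∞ → ℕ∞) λ g → InΩ g × Slow g × (g ∼ h) ×
      All (λ ρ → BoundedBy (Inverse.to ρ) g) E
corollary3p1 h H h-slow E _ E-in with chunk-bound H E E-in
... | G , K , G-mono , G≺hᴷ , E-bounded =
  g , g-Ω , slowℕ⇒slow {g} g-slow , g∼h , boundsAll-weaken (λ x → ≤⊔∞ʳ (hᴷ⁺¹ x) (G x)) E-bounded
  where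
  hᴷ⁺¹ = h ^ suc K
  g : ℕ∞ → ℕ∞
  g = hᴷ⁺¹ ⊔ᶠ G
  g-Ω : InΩ g
  g-Ω = ⊔ᶠ-Ω (Ω-^ H K) G-mono
  -- G ≺ h^(K+1), so the maximum is eventually h^(K+1), a slow function
  g≡hᴷ⁺¹ : Eventually (λ n → g (fin n) ≡ hᴷ⁺¹ (fin n))
  g≡hᴷ⁺¹ = eventually-map ⊔∞-absorb (≺-^-raise {G} H (ℕP.n≤1+n K) G≺hᴷ)
  g-slow : Slowℕ g
  g-slow = slowℕ-eventual {hᴷ⁺¹} {g} g≡hᴷ⁺¹ (slowℕ-^ {h} (slow⇒slowℕ H h-slow) K)
  h≤g : ∀ n → h (fin n) ≤∞ g (fin n)
  h≤g n = ≤∞-trans (^-≤ H {1} {suc K} (s≤s z≤n) (fin n)) (≤⊔∞ˡ _ _)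
  g∼h : g ∼ h
  g∼h = eventual-power-∼ {h} {g} K H g-Ω h≤g g≡hᴷ⁺¹ (slowℕ-finite {g} g-slow)
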